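{- If $G=(X,Y;E)$ is an $(a,b)$-biregular bipartite graph (without multiple edges), with all vertices of $X$ of degree $a$ and all vertices of $Y$ of degree $b$, then $G$ has an $X$-interval edge coloring with at most $ab$ colors.
   Context: For a bipartite graph $G$ with parts $X$ and $Y$, an $X$-interval coloring is a proper edge coloring of $G$ by integers such that, for every vertex $x\in X$, the set of colors on the edges incident to $x$ forms an interval of consecutive integers. A bipartite graph is $(a,b)$-biregular if all vertices of $X$ have degree $a$ and all vertices of $Y$ have degree $b$. -}

module Defs where

open import Data.Nat using (ℕ; zero; suc; _+_; _≤_)
open import Data.Bool using (Bool; true; false; T)
open import Data.Fin using (Fin)
open import Data.Product using (Σ; _×_; ∃; ∃-syntax)
open import Relation.Binary.PropositionalEquality using (_≡_; _≢_)
open import Function.Bundles using (_⇔_)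

countᵇ : ∀ {k} → (Fin k → Bool) → ℕ
countᵇ {zero}  p = 0
countᵇ {suc k} p with p Fin.zero
... | true  = suc (countᵇ (λ i → p (Fin.suc i)))
... | false = countᵇ (λ i → p (Fin.suc i))

-- A simple bipartite graph with parts X = Fin m and Y = Fin n,
-- given by its (Boolean) bipartite adjacency relation.
-- Having no multiple edges is automatic in this representation.
BipGraph : ℕ → ℕ → Set
BipGraph m n = Fin m → Fin n → Bool

degX : ∀ {m n} → BipGraph m n → Fin m → ℕ
degX G x = countᵇ (λ y → G x y)

degY : ∀ {m n} → BipGraph m n → Fin n → ℕ
degY G y = countᵇ (λ x → G x y)

Biregular : ∀ {m n} → BipGraph m n → ℕ → ℕ → Set
Biregular G a b = (∀ x → degX G x ≡ a) × (∀ y → degY G y ≡ b)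

-- An edge colouring assigns an integer colour to every pair; only the
-- values on edges (G x y = true) matter.
Colouring : ℕ → ℕ → Set
Colouring m n = Fin m → Fin n → ℕ

Proper : ∀ {m n} → BipGraph m n → Colouring m n → Set
Proper {m} {n} G c =
  (∀ x (y y′ : Fin n) → T (G x y) → T (G x y′) → y ≢ y′ → c x y ≢ c x y′) ×
  (∀ (x x′ : Fin m) y → T (G x y) → T (G x′ y) → x ≢ x′ → c x y ≢ c x′ y)

IntervalAt : ∀ {m n} → BipGraph m n → Colouring m n → Fin m → Set
IntervalAt {m} {n} G c x =
  ∃[ lo ] ∃[ hi ] (∀ k → ((lo ≤ k × k ≤ hi) ⇔ (∃[ y ] (T (G x y) × c x y ≡ k))))

XIntervalColouring : ∀ {m n} → BipGraph m n → Colouring m n → Set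
XIntervalColouring G c = Proper G c × (∀ x → IntervalAt G c x)

UsesColours≤ : ∀ {m n} → BipGraph m n → Colouring m n → ℕ → Set
UsesColours≤ G c t = ∀ x y → T (G x y) → (1 ≤ c x y × c x y ≤ t)

{-# OPTIONS --safe #-}
-- Colour the edges at each x ∈ X consecutively, s x, s x + 1, …, in a fixed
-- order of its neighbours, so every X-vertex sees an interval; only the start
-- s x is free.  Choose the starts greedily.  A start for x clashes with an
-- edge x′y (y a neighbour of x) for exactly one value, so at most a(b − 1)
-- values are forbidden and some start in [1, a(b − 1) + 1] is free; the
-- largest colour is then at most a(b − 1) + 1 + (a − 1) = ab.
module Submission where

open import Defs
open import Data.Nat using (ℕ; zero; suc; pred; _+_; _*_; _∸_; _≤_; _<_; _≤?_; _≟_; z≤n; s≤s; s≤s⁻¹; >-nonZero)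
open import Data.Nat.Properties
open import Data.Bool using (Bool; true; false; T)
open import Data.Empty using (⊥-elim)
open import Data.Fin using (Fin; toℕ)
open import Data.Fin.Properties using (pigeonhole; toℕ<n; toℕ-injective; all?; ¬∀⟶∃¬)
open import Data.Product using (_×_; ∃-syntax; _,_; proj₁; proj₂)
open import Data.List using (List; []; _∷_; length; concat; _++_; lookup)
open import Data.List.Properties using (length-++)
open import Data.List.Relation.Unary.Any using (here; there; index)
open import Data.List.Relation.Unary.Any.Properties using (lookup-index)
open import Data.List.Membership.Propositional using (_∈_; _∉_)
open import Data.List.Membership.Propositional.Properties using (∈-concat⁺′)
open import Data.List.Membership.DecPropositional _≟_ using (_∈?_)
open import Data.Vec.Functional as Vector using (tail)
open import Function.Base using (_∘_)
open import Function.Definitions using (Injective)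
open import Function.Bundles using (mk⇔)
open import Relation.Nullary using (yes; no)
open import Relation.Binary.PropositionalEquality

-- rank p j is the number of i < j with p i, so on the support of p it
-- enumerates 0, 1, …, countᵇ p − 1 in increasing order of j.
rank : ∀ {k} → (Fin k → Bool) → Fin k → ℕ
rank p Fin.zero = 0
rank p (Fin.suc j) with p Fin.zero
... | true  = suc (rank (tail p) j)
... | false = rank (tail p) j

rank-suc-true : ∀ {k} (p : Fin (suc k) → Bool) (j : Fin k) → p Fin.zero ≡ true →
  rank p (Fin.suc j) ≡ suc (rank (tail p) j)
rank-suc-true p j eq rewrite eq = refl

rank-suc-false : ∀ {k} (p : Fin (suc k) → Bool) (j : Fin k) → p Fin.zero ≡ false →
  rank p (Fin.suc j) ≡ rank (tail p) j
rank-suc-false p j eq rewrite eq = refl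

countᵇ-suc : ∀ {k} (p : Fin (suc k) → Bool) → T (p Fin.zero) → countᵇ p ≡ suc (countᵇ (tail p))
countᵇ-suc p t with p Fin.zero
... | true = refl

countᵇ-tail≤ : ∀ {k} (p : Fin (suc k) → Bool) → countᵇ (tail p) ≤ countᵇ p
countᵇ-tail≤ p with p Fin.zero
... | true  = n≤1+n _
... | false = ≤-refl

rank-injective : ∀ {k} (p : Fin k → Bool) {i j : Fin k} → T (p i) → T (p j) →
  rank p i ≡ rank p j → i ≡ j
rank-injective p {Fin.zero} {Fin.zero} _ _ _ = refl
rank-injective p {Fin.zero} {Fin.suc j} ti tj e with p Fin.zero
rank-injective p {Fin.zero} {Fin.suc j} ti tj () | true
rank-injective p {Fin.zero} {Fin.suc j} () tj e | false
rank-injective p {Fin.suc i} {Fin.zero} ti tj e with p Fin.zero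
rank-injective p {Fin.suc i} {Fin.zero} ti tj () | true
rank-injective p {Fin.suc i} {Fin.zero} ti () e | false
rank-injective p {Fin.suc i} {Fin.suc j} ti tj e with p Fin.zero
... | true  = cong Fin.suc (rank-injective (tail p) ti tj (suc-injective e))
... | false = cong Fin.suc (rank-injective (tail p) ti tj e)

rank<countᵇ : ∀ {k} (p : Fin k → Bool) (j : Fin k) → T (p j) → rank p j < countᵇ p
rank<countᵇ p Fin.zero t with p Fin.zero
... | true = s≤s z≤n
rank<countᵇ p Fin.zero () | false
rank<countᵇ p (Fin.suc j) t with p Fin.zero
... | true  = s≤s (rank<countᵇ (tail p) j t)
... | false = rank<countᵇ (tail p) j t

rank-surjective : ∀ {k} (p : Fin k → Bool) {r : ℕ} → r < countᵇ p →
  ∃[ j ] (T (p j) × rank p j ≡ r)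
rank-surjective {zero} p ()
rank-surjective {suc k} p {r} lt with p Fin.zero in eq
rank-surjective {suc k} p {zero} lt | true = Fin.zero , subst T (sym eq) _ , refl
rank-surjective {suc k} p {suc r} lt | true with rank-surjective (tail p) (s≤s⁻¹ lt)
... | j , tj , e = Fin.suc j , tj , trans (rank-suc-true p j eq) (cong suc e)
rank-surjective {suc k} p {r} lt | false with rank-surjective (tail p) lt
... | j , tj , e = Fin.suc j , tj , trans (rank-suc-false p j eq) e

countᵇ-pos : ∀ {k} (p : Fin k → Bool) {j : Fin k} → T (p j) → 0 < countᵇ p
countᵇ-pos p {j} t = ≤-trans (s≤s z≤n) (rank<countᵇ p j t)

select : ∀ {k} {A : Set} → (Fin k → Bool) → (Fin k → A) → List A
select {zero}  p f = []
select {suc k} p f with p Fin.zero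
... | true  = f Fin.zero ∷ select (tail p) (tail f)
... | false = select (tail p) (tail f)

∈-select : ∀ {k} {A : Set} (p : Fin k → Bool) (f : Fin k → A) {i : Fin k} → T (p i) → f i ∈ select p f
∈-select p f {Fin.zero} t with p Fin.zero
... | true = here refl
∈-select p f {Fin.zero} () | false
∈-select p f {Fin.suc i} t with p Fin.zero
... | true  = there (∈-select (tail p) (tail f) t)
... | false = ∈-select (tail p) (tail f) t

length-select : ∀ {k} {A : Set} (p : Fin k → Bool) (f : Fin k → A) → length (select p f) ≡ countᵇ p
length-select {zero} p f = refl
length-select {suc k} p f with p Fin.zero
... | true  = cong suc (length-select (tail p) (tail f))
... | false = length-select (tail p) (tail f)

length-concat-select≤ : ∀ {k} {A : Set} (p : Fin k → Bool) (f : Fin k → List A) {B : ℕ} →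
  (∀ i → T (p i) → length (f i) ≤ B) → length (concat (select p f)) ≤ countᵇ p * B
length-concat-select≤ {zero} p f h = z≤n
length-concat-select≤ {suc k} p f {B} h with p Fin.zero in eq
... | false = length-concat-select≤ (tail p) (tail f) (h ∘ Fin.suc)
... | true  = begin
  length (f Fin.zero ++ rest)         ≡⟨ length-++ (f Fin.zero) ⟩
  length (f Fin.zero) + length rest   ≤⟨ +-mono-≤ (h Fin.zero (subst T (sym eq) _))
                                          (length-concat-select≤ (tail p) (tail f) (h ∘ Fin.suc)) ⟩
  B + countᵇ (tail p) * B             ∎
  where
  open ≤-Reasoning
  rest = concat (select (tail p) (tail f))

injection⇒≤length : ∀ {k} {A : Set} (L : List A) (f : Fin k → A) → Injective _≡_ _≡_ f →
  (∀ i → f i ∈ L) → k ≤ length L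
injection⇒≤length {k} L f f-inj f∈L with k ≤? length L
... | yes k≤len = k≤len
... | no k≰len with i , j , i<j , same-pos ← pigeonhole (≰⇒> k≰len) (index ∘ f∈L) =
  ⊥-elim (<-irrefl (cong toℕ (f-inj f[i]≡f[j])) i<j)
  where
  f[i]≡f[j] : f i ≡ f j
  f[i]≡f[j] = begin
    f i                       ≡⟨ lookup-index (f∈L i) ⟩
    lookup L (index (f∈L i))  ≡⟨ cong (lookup L) same-pos ⟩
    lookup L (index (f∈L j))  ≡⟨ lookup-index (f∈L j) ⟨
    f j                       ∎
    where open ≡-Reasoning

-- Pigeonhole: the length L + 1 values 1, …, length L + 1 cannot all occur in L.
fresh : (L : List ℕ) → ∃[ v ] (1 ≤ v × v ≤ suc (length L) × v ∉ L)
fresh L with all? (λ (i : Fin (suc (length L))) → suc (toℕ i) ∈? L)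
... | yes all∈ = ⊥-elim (1+n≰n (injection⇒≤length L (suc ∘ toℕ) (toℕ-injective ∘ suc-injective) all∈))
... | no ¬all∈ with i , i∉L ← ¬∀⟶∃¬ _ _ (λ i → suc (toℕ i) ∈? L) ¬all∈ =
  suc (toℕ i) , s≤s z≤n , toℕ<n i , i∉L

consecutiveFrom : ∀ {m n} → (Fin m → ℕ) → BipGraph m n → Colouring m n
consecutiveFrom s G x y = s x + rank (G x) y

module _ {m n} (s : Fin m → ℕ) (G : BipGraph m n) where

  private
    c = consecutiveFrom s G

  consecutiveFrom-properˣ : ∀ x (y y′ : Fin n) → T (G x y) → T (G x y′) → y ≢ y′ → c x y ≢ c x y′
  consecutiveFrom-properˣ x y y′ t t′ y≢y′ e =
    y≢y′ (rank-injective (G x) t t′ (+-cancelˡ-≡ (s x) _ _ e))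

  consecutiveFrom-interval : ∀ x → 1 ≤ s x → IntervalAt G c x
  consecutiveFrom-interval x 1≤s = s x , pred (s x + degX G x) , λ k → mk⇔ (to k) (from k)
    where
    offset<deg : ∀ {k} → s x ≤ k → k ≤ pred (s x + degX G x) → k ∸ s x < degX G x
    offset<deg {k} s≤k k≤hi = +-cancelˡ-< (s x) _ _ (subst (_< s x + degX G x) (sym (m+[n∸m]≡n s≤k)) k<s+deg)
      where
      k<s+deg : k < s x + degX G x
      k<s+deg = m≤pred[n]⇒suc[m]≤n {{>-nonZero (≤-trans 1≤s (m≤m+n _ _))}} k≤hi
    to : ∀ k → s x ≤ k × k ≤ pred (s x + degX G x) → ∃[ y ] (T (G x y) × c x y ≡ k)
    to k (s≤k , k≤hi) with y , t , e ← rank-surjective (G x) (offset<deg s≤k k≤hi) =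
      y , t , trans (cong (s x +_) e) (m+[n∸m]≡n s≤k)
    from : ∀ k → ∃[ y ] (T (G x y) × c x y ≡ k) → s x ≤ k × k ≤ pred (s x + degX G x)
    from k (y , t , refl) = m≤m+n _ _ , <⇒≤pred (+-monoʳ-< (s x) (rank<countᵇ (G x) y t))

  consecutiveFrom-≤ : ∀ {a b} x y → s x ≤ suc b → degX G x ≤ a → T (G x y) → c x y ≤ b + a
  consecutiveFrom-≤ {a} {b} x y s≤ deg≤ t = begin
    s x + rank (G x) y      ≤⟨ +-monoˡ-≤ _ s≤ ⟩
    suc b + rank (G x) y    ≡⟨ +-suc b _ ⟨
    b + suc (rank (G x) y)  ≤⟨ +-monoʳ-≤ b (≤-trans (rank<countᵇ (G x) y t) deg≤) ⟩
    b + a                   ∎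
    where open ≤-Reasoning

-- Starting the first vertex x₀ at v makes its edge to y clash with the edge x y
-- exactly when v + rank (G x₀) y equals the colour of x y.
conflicts : ∀ {m n} → BipGraph (suc m) n → (Fin m → ℕ) → List ℕ
conflicts G s = concat (select (G Fin.zero) λ y →
  select (λ x → G (Fin.suc x) y) λ x → consecutiveFrom s (tail G) x y ∸ rank (G Fin.zero) y)

greedyStarts : ∀ {m n} → BipGraph m n → Fin m → ℕ
greedyStarts {zero}  G = λ ()
greedyStarts {suc m} G = proj₁ (fresh (conflicts G s)) Vector.∷ s
  where s = greedyStarts (tail G)

greedyColouring : ∀ {m n} → BipGraph m n → Colouring m n
greedyColouring G = consecutiveFrom (greedyStarts G) G

greedyStarts-pos : ∀ {m n} (G : BipGraph m n) x → 1 ≤ greedyStarts G x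
greedyStarts-pos {suc m} G Fin.zero    = proj₁ (proj₂ (fresh (conflicts G (greedyStarts (tail G)))))
greedyStarts-pos {suc m} G (Fin.suc x) = greedyStarts-pos (tail G) x

length-conflicts≤ : ∀ {m n} (G : BipGraph (suc m) n) (s : Fin m → ℕ) {a b} →
  degX G Fin.zero ≤ a → (∀ y → degY G y ≤ suc b) → length (conflicts G s) ≤ a * b
length-conflicts≤ G s {a} {b} deg≤ degʸ≤ =
  ≤-trans (length-concat-select≤ (G Fin.zero) _ other-ends≤) (*-monoˡ-≤ b deg≤)
  where
  other-ends≤ : ∀ y → T (G Fin.zero y) → length (select (λ x → G (Fin.suc x) y) _) ≤ b
  other-ends≤ y t = begin
    length (select (λ x → G (Fin.suc x) y) _) ≡⟨ length-select (λ x → G (Fin.suc x) y) _ ⟩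
    countᵇ (λ x → G (Fin.suc x) y)            ≤⟨ s≤s⁻¹ (subst (_≤ suc b) (countᵇ-suc (λ x → G x y) t) (degʸ≤ y)) ⟩
    b                                          ∎
    where open ≤-Reasoning

greedyStarts-≤ : ∀ {m n} (G : BipGraph m n) {a b} → (∀ x → degX G x ≤ a) → (∀ y → degY G y ≤ suc b) →
  ∀ x → greedyStarts G x ≤ suc (a * b)
greedyStarts-≤ {suc m} G degˣ≤ degʸ≤ Fin.zero = ≤-trans
  (proj₁ (proj₂ (proj₂ (fresh (conflicts G (greedyStarts (tail G)))))))
  (s≤s (length-conflicts≤ G _ (degˣ≤ Fin.zero) degʸ≤))
greedyStarts-≤ {suc m} G degˣ≤ degʸ≤ (Fin.suc x) =
  greedyStarts-≤ (tail G) (degˣ≤ ∘ Fin.suc) (λ y → ≤-trans (countᵇ-tail≤ (λ x → G x y)) (degʸ≤ y)) x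

greedy-first-avoids : ∀ {m n} (G : BipGraph (suc m) n) x y → T (G Fin.zero y) → T (G (Fin.suc x) y) →
  greedyColouring G Fin.zero y ≢ greedyColouring G (Fin.suc x) y
greedy-first-avoids G x y t t′ clash = v∉conflicts (subst (_∈ conflicts G s) v≡ clashing-start)
  where
  s = greedyStarts (tail G)
  v = greedyStarts G Fin.zero
  r = rank (G Fin.zero) y
  v∉conflicts : v ∉ conflicts G s
  v∉conflicts = proj₂ (proj₂ (proj₂ (fresh (conflicts G s))))
  clashing-start : greedyColouring G (Fin.suc x) y ∸ r ∈ conflicts G s
  clashing-start = ∈-concat⁺′ (∈-select (λ x → G (Fin.suc x) y) _ t′) (∈-select (G Fin.zero) _ t)
  v≡ : greedyColouring G (Fin.suc x) y ∸ r ≡ v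
  v≡ = trans (cong (_∸ r) (sym clash)) (m+n∸n≡m v r)

greedy-properʸ : ∀ {m n} (G : BipGraph m n) (x x′ : Fin m) y → T (G x y) → T (G x′ y) → x ≢ x′ →
  greedyColouring G x y ≢ greedyColouring G x′ y
greedy-properʸ G Fin.zero     Fin.zero      y t t′ x≢x′ = ⊥-elim (x≢x′ refl)
greedy-properʸ G Fin.zero     (Fin.suc x′)  y t t′ x≢x′ = greedy-first-avoids G x′ y t t′
greedy-properʸ G (Fin.suc x)  Fin.zero      y t t′ x≢x′ = greedy-first-avoids G x y t′ t ∘ sym
greedy-properʸ G (Fin.suc x)  (Fin.suc x′)  y t t′ x≢x′ =
  greedy-properʸ (tail G) x x′ y t t′ (x≢x′ ∘ cong Fin.suc)

greedy-XInterval : ∀ {m n} (G : BipGraph m n) → XIntervalColouring G (greedyColouring G)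
greedy-XInterval G =
  (consecutiveFrom-properˣ (greedyStarts G) G , greedy-properʸ G) ,
  λ x → consecutiveFrom-interval (greedyStarts G) G x (greedyStarts-pos G x)

greedy-usesColours≤ : ∀ {m n} (G : BipGraph m n) {a b} → (∀ x → degX G x ≤ a) → (∀ y → degY G y ≤ suc b) →
  UsesColours≤ G (greedyColouring G) (a * suc b)
greedy-usesColours≤ G {a} {b} degˣ≤ degʸ≤ x y t =
  ≤-trans (greedyStarts-pos G x) (m≤m+n _ _) ,
  ≤-trans (consecutiveFrom-≤ (greedyStarts G) G x y (greedyStarts-≤ G degˣ≤ degʸ≤ x) (degˣ≤ x) t)
          (≤-reflexive (trans (+-comm (a * b) a) (sym (*-suc a b))))

proposition2p3 : ∀ {m n} (G : BipGraph m n) (a b : ℕ) → Biregular G a b →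
    ∃[ c ] (XIntervalColouring G c × UsesColours≤ G c (a * b))
proposition2p3 G a zero (_ , regʸ) =
  greedyColouring G , greedy-XInterval G ,
  λ x y t → ⊥-elim (n≮0 (subst (0 <_) (regʸ y) (countᵇ-pos (λ x → G x y) t)))
proposition2p3 G a (suc b) (regˣ , regʸ) =
  greedyColouring G , greedy-XInterval G ,
  greedy-usesColours≤ G (≤-reflexive ∘ regˣ) (≤-reflexive ∘ regʸ)
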